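{- For all integers $d\geq 0$, $0<i\leq d+1$ and $j$, $$f_j(S(i,d))=f_j(S(i,d-1))+f_{j-1}(S(i,d-1))+f_{j-r}(S(i,d-r)),$$ where $d+1=qi+r$ with integers $q\geq 0$ and $1\leq r\leq i$.
   Context: $f_j(\Delta)$ is the number of $j$-dimensional faces (faces of cardinality $j+1$) of a simplicial complex $\Delta$; the empty face has dimension $-1$, so $f_{ -1}=1$ for a nonempty complex, and $f_j=0$ for $j<-1$. For $m\geq 1$, $\partial\sigma^m$ is the boundary of the $m$-simplex (all proper subsets of an $(m+1)$-element set), and $*$ is the join. For integers $e\geq 0$ and $i>0$, write $e+1=q'i+r'$ with $q'\geq 0$, $1\leq r'\leq i$, and set $S(i,e)=\partial\sigma^i*\cdots*\partial\sigma^i*\partial\sigma^{r'}$ with $q'$ copies of $\partial\sigma^i$ (an $e$-dimensional sphere). By convention $S(i,-1)=\{\emptyset\}$, the complex consisting only of the empty face. -}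

module Defs where

open import Data.Nat as ℕ using (ℕ; zero; suc; _+_; _*_; _<_; NonZero; >-nonZero)
open import Data.Nat.DivMod using (_/_; _%_)
open import Data.Bool using (Bool; true; false; _∧_; not; T)
open import Data.Bool.Properties using (T?)
open import Data.Vec using (Vec; []; _∷_; take; drop)
open import Data.List using (List; []; _∷_; map; _++_; length; filter)
open import Data.Fin.Subset using (Subset; ∣_∣)
open import Data.Integer as ℤ using (ℤ; +_; 1ℤ)
open import Relation.Nullary.Decidable using (_×-dec_)

record SC : Set where
  field
    n    : ℕ
    face : Subset n → Bool
open SC public

allSubsets : (n : ℕ) → List (Subset n)
allSubsets zero    = [] ∷ []
allSubsets (suc n) = map (true ∷_) (allSubsets n) ++ map (false ∷_) (allSubsets n)

fnum : ℤ → SC → ℕ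
fnum j K = length (filter (λ σ → T? (face K σ) ×-dec ((+ ∣ σ ∣) ℤ.≟ (j ℤ.+ 1ℤ))) (allSubsets (n K)))

emptyFaceComplex : SC
emptyFaceComplex = record { n = 0 ; face = λ _ → true }

isFull : ∀ {m} → Subset m → Bool
isFull []       = true
isFull (b ∷ σ)  = b ∧ isFull σ

∂σ : ℕ → SC
∂σ m = record { n = suc m ; face = λ σ → not (isFull σ) }

_⋆_ : SC → SC → SC
K ⋆ L = record { n = n K + n L
               ; face = λ σ → face K (take (n K) σ) ∧ face L (drop (n K) σ) }

joinPow : ℕ → SC → SC → SC
joinPow zero    A B = B
joinPow (suc q) A B = A ⋆ joinPow q A B

-- Sph i h k = S(i, k-1), i.e. the argument k is e+1 where e ≥ -1 is the dimension.
-- For k = e+1 ≥ 1: e+1 = q'i + r' with q' = e / i and r' = e % i + 1 ∈ [1, i].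
Sph : (i : ℕ) → 0 < i → ℕ → SC
Sph i h zero    = emptyFaceComplex
Sph i h (suc e) = joinPow (_/_ e i {{>-nonZero h}}) (∂σ i) (∂σ (suc (_%_ e i {{>-nonZero h}})))

-- Identify a complex K with multiplication of power series by its face polynomial
-- P_K = Σ_{σ ∈ K} x^|σ|, acting on sequences ℕ → ℕ; the coefficient of x^k in P_K is f_{k-1}(K).
-- A join multiplies face polynomials. Splitting off one vertex gives
-- P_{∂σ^(m+1)} = (1 + x) P_{∂σ^m} + x^(m+1), where ∂σ^0, whose only face is ∅, has P = 1.
-- Writing d + 1 = q i + r and A = ∂σ^i we get S(i,d) = A^q * ∂σ^r, S(i,d-1) = A^q * ∂σ^(r-1)
-- and P_{S(i,d-r)} = P_A^q, so P_{S(i,d)} = (1 + x) P_{S(i,d-1)} + x^r P_{S(i,d-r)}, which is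
-- the recursion read coefficientwise.
module Submission where

open import Defs
open import Data.Nat using (ℕ; suc; _+_; _*_; _<_; _≤_; _∸_)
open import Data.Integer using (ℤ; +_; _-_; 1ℤ)
open import Relation.Binary.PropositionalEquality using (_≡_)

open import Data.Nat as ℕ using (zero; NonZero)
open import Data.Nat.Properties as ℕ
  using (+-identityʳ; +-comm; *-identityˡ; *-zeroʳ; *-distribˡ-+; +-suc; suc-injective; m+n∸n≡m)
open import Data.Nat.DivMod
  using (_/_; _%_; +-distrib-/-∣ˡ; m*n/n≡m; m<n⇒m/n≡0; [m+kn]%n≡m%n; m<n⇒m%n≡m)
open import Data.Nat.Divisibility using (n∣m*n)
import Data.Integer as ℤ
import Data.Integer.Properties as ℤ
open import Algebra.Properties.CommutativeSemigroup ℕ.+-commutativeSemigroup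
  using (interchange; x∙yz≈yx∙z)
open import Algebra.Properties.CommutativeSemigroup ℤ.+-commutativeSemigroup
  using (xy∙z≈xz∙y)
open import Data.Bool using (Bool; true; false; _∧_; not)
open import Data.Bool.Properties using (T?)
open import Data.Vec using (_∷_; take; drop)
open import Data.List using (List; []; _∷_; map; _++_; length; filter)
open import Data.List.Properties using (map-++; map-cong; map-∘)
open import Data.Nat.ListAction using (sum)
open import Data.Nat.ListAction.Properties using (sum-++)
open import Data.Fin.Subset using (Subset; ∣_∣)
open import Relation.Nullary using (Dec; does)
open import Relation.Nullary.Decidable using (_×-dec_)
open import Relation.Binary.PropositionalEquality
  using (refl; sym; trans; cong; cong₂; _≗_; module ≡-Reasoning)
open import Function using (_∘_)

open ≡-Reasoning

private
  variable
    A B : Set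

∑ : List A → (A → ℕ) → ℕ
∑ xs f = sum (map f xs)

syntax ∑ xs (λ x → e) = ∑[ x ∈ xs ] e

∑-++ : (xs ys : List A) (f : A → ℕ) → ∑ (xs ++ ys) f ≡ ∑ xs f + ∑ ys f
∑-++ xs ys f = trans (cong sum (map-++ f xs ys)) (sum-++ (map f xs) (map f ys))

∑-map : (g : A → B) (xs : List A) (f : B → ℕ) → ∑ (map g xs) f ≡ ∑ xs (f ∘ g)
∑-map g xs f = cong sum (sym (map-∘ xs))

∑-cong : (xs : List A) {f g : A → ℕ} → f ≗ g → ∑ xs f ≡ ∑ xs g
∑-cong xs f≗g = cong sum (map-cong f≗g xs)

∑-⊕ : (xs : List A) (f g : A → ℕ) → ∑[ x ∈ xs ] (f x + g x) ≡ ∑ xs f + ∑ xs g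
∑-⊕ []       f g = refl
∑-⊕ (x ∷ xs) f g =
  trans (cong (_+_ (f x + g x)) (∑-⊕ xs f g)) (interchange (f x) (g x) (∑ xs f) (∑ xs g))

∑-zero : (xs : List A) → ∑[ x ∈ xs ] 0 ≡ 0
∑-zero []       = refl
∑-zero (x ∷ xs) = ∑-zero xs

∑-*-zeroʳ : (xs : List A) (c : A → ℕ) → ∑[ x ∈ xs ] (c x * 0) ≡ 0
∑-*-zeroʳ xs c = trans (∑-cong xs (λ x → *-zeroʳ (c x))) (∑-zero xs)

*-distribˡ-∑ : (c : ℕ) (xs : List A) (f : A → ℕ) → c * ∑ xs f ≡ ∑[ x ∈ xs ] (c * f x)
*-distribˡ-∑ c []       f = *-zeroʳ c
*-distribˡ-∑ c (x ∷ xs) f = trans (*-distribˡ-+ c (f x) _) (cong (_+_ (c * f x)) (*-distribˡ-∑ c xs f))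

𝟙[_] : Bool → ℕ
𝟙[ true  ] = 1
𝟙[ false ] = 0

𝟙[∧] : ∀ b c x → 𝟙[ b ∧ c ] * x ≡ 𝟙[ b ] * (𝟙[ c ] * x)
𝟙[∧] true  c x = sym (+-identityʳ _)
𝟙[∧] false c x = refl

𝟙[not-b]+𝟙[b] : ∀ b x → 𝟙[ not b ] * x + 𝟙[ b ] * x ≡ x
𝟙[not-b]+𝟙[b] true  x = +-identityʳ x
𝟙[not-b]+𝟙[b] false x = trans (+-identityʳ _) (+-identityʳ x)

length-filter≡∑ : {P : A → Set} (P? : ∀ x → Dec (P x)) (xs : List A) →
                  length (filter P? xs) ≡ ∑[ x ∈ xs ] 𝟙[ does (P? x) ]
length-filter≡∑ P? []       = refl
length-filter≡∑ P? (x ∷ xs) with does (P? x)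
... | true  = cong suc (length-filter≡∑ P? xs)
... | false = length-filter≡∑ P? xs

∑-allSubsets-suc : ∀ p (F : Subset (suc p) → ℕ) →
  ∑ (allSubsets (suc p)) F ≡ ∑ (allSubsets p) (F ∘ (true ∷_)) + ∑ (allSubsets p) (F ∘ (false ∷_))
∑-allSubsets-suc p F = trans (∑-++ (map (true ∷_) S) (map (false ∷_) S) F)
                             (cong₂ _+_ (∑-map (true ∷_) S F) (∑-map (false ∷_) S F))
  where S = allSubsets p

∑-allSubsets-+ : ∀ p m (F : Subset p → Subset m → ℕ) →
  ∑[ ρ ∈ allSubsets (p + m) ] F (take p ρ) (drop p ρ) ≡ ∑[ σ ∈ allSubsets p ] ∑ (allSubsets m) (F σ)
∑-allSubsets-+ zero    m F = sym (+-identityʳ _)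
∑-allSubsets-+ (suc p) m F = begin
  ∑[ ρ ∈ allSubsets (suc p + m) ] F (take (suc p) ρ) (drop (suc p) ρ)
    ≡⟨ ∑-allSubsets-suc (p + m) _ ⟩
  ∑[ ρ ∈ allSubsets (p + m) ] F (true ∷ take p ρ) (drop p ρ)
    + ∑[ ρ ∈ allSubsets (p + m) ] F (false ∷ take p ρ) (drop p ρ)
    ≡⟨ cong₂ _+_ (∑-allSubsets-+ p m (F ∘ (true ∷_))) (∑-allSubsets-+ p m (F ∘ (false ∷_))) ⟩
  ∑[ σ ∈ allSubsets p ] ∑ (allSubsets m) (F (true ∷ σ))
    + ∑[ σ ∈ allSubsets p ] ∑ (allSubsets m) (F (false ∷ σ))
    ≡⟨ ∑-allSubsets-suc p _ ⟨
  ∑[ σ ∈ allSubsets (suc p) ] ∑ (allSubsets m) (F σ) ∎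

∑-allSubsets-isFull : ∀ p (g : ℕ → ℕ) → ∑[ τ ∈ allSubsets p ] (𝟙[ isFull τ ] * g ∣ τ ∣) ≡ g p
∑-allSubsets-isFull zero    g = trans (+-identityʳ _) (+-identityʳ _)
∑-allSubsets-isFull (suc p) g =
  trans (∑-allSubsets-suc p _)
        (trans (cong₂ _+_ (∑-allSubsets-isFull p (g ∘ suc)) (∑-zero (allSubsets p))) (+-identityʳ _))

∣ρ∣≡∣take∣+∣drop∣ : ∀ p {m} (ρ : Subset (p + m)) → ∣ ρ ∣ ≡ ∣ take p ρ ∣ + ∣ drop p ρ ∣
∣ρ∣≡∣take∣+∣drop∣ zero    ρ           = refl
∣ρ∣≡∣take∣+∣drop∣ (suc p) (true  ∷ ρ) = cong suc (∣ρ∣≡∣take∣+∣drop∣ p ρ)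
∣ρ∣≡∣take∣+∣drop∣ (suc p) (false ∷ ρ) = ∣ρ∣≡∣take∣+∣drop∣ p ρ

infixl 6 _⊕_
_⊕_ : (ℕ → ℕ) → (ℕ → ℕ) → ℕ → ℕ
(f ⊕ g) k = f k + g k

δ₀ : ℕ → ℕ
δ₀ zero    = 1
δ₀ (suc _) = 0

shift : ℕ → (ℕ → ℕ) → ℕ → ℕ
shift zero    f k       = f k
shift (suc a) f zero    = 0
shift (suc a) f (suc k) = shift a f k

shift-cong : ∀ a {f g} → f ≗ g → shift a f ≗ shift a g
shift-cong zero    f≗g k       = f≗g k
shift-cong (suc a) f≗g zero    = refl
shift-cong (suc a) f≗g (suc k) = shift-cong a f≗g k

shift-⊕ : ∀ a f g → shift a (f ⊕ g) ≗ shift a f ⊕ shift a g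
shift-⊕ zero    f g k       = refl
shift-⊕ (suc a) f g zero    = refl
shift-⊕ (suc a) f g (suc k) = shift-⊕ a f g k

shift-shift : ∀ a b f → shift a (shift b f) ≗ shift (a + b) f
shift-shift zero    b f k       = refl
shift-shift (suc a) b f zero    = refl
shift-shift (suc a) b f (suc k) = shift-shift a b f k

shift-comm : ∀ a b f → shift a (shift b f) ≗ shift b (shift a f)
shift-comm a b f k = begin
  shift a (shift b f) k ≡⟨ shift-shift a b f k ⟩
  shift (a + b) f k     ≡⟨ cong (λ s → shift s f k) (+-comm a b) ⟩
  shift (b + a) f k     ≡⟨ shift-shift b a f k ⟨
  shift b (shift a f) k ∎

shift-linear : ∀ a (xs : List A) (c : A → ℕ) (h : A → ℕ → ℕ) →
  shift a (λ k → ∑[ x ∈ xs ] (c x * h x k)) ≗ (λ k → ∑[ x ∈ xs ] (c x * shift a (h x) k))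
shift-linear zero    xs c h k       = refl
shift-linear (suc a) xs c h zero    = sym (∑-*-zeroʳ xs c)
shift-linear (suc a) xs c h (suc k) = shift-linear a xs c h k

fMul : SC → (ℕ → ℕ) → ℕ → ℕ
fMul K f k = ∑[ σ ∈ allSubsets (n K) ] (𝟙[ face K σ ] * shift ∣ σ ∣ f k)

faceCount : SC → ℕ → ℕ
faceCount K = fMul K δ₀

fMul-cong : ∀ K {f g} → f ≗ g → fMul K f ≗ fMul K g
fMul-cong K f≗g k = ∑-cong (allSubsets (n K)) (λ σ → cong (𝟙[ face K σ ] *_) (shift-cong ∣ σ ∣ f≗g k))

fMul-⊕ : ∀ K f g → fMul K (f ⊕ g) ≗ fMul K f ⊕ fMul K g
fMul-⊕ K f g k = trans
  (∑-cong (allSubsets (n K)) (λ σ →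
     trans (cong (𝟙[ face K σ ] *_) (shift-⊕ ∣ σ ∣ f g k)) (*-distribˡ-+ 𝟙[ face K σ ] _ _)))
  (∑-⊕ (allSubsets (n K)) _ _)

fMul-shift : ∀ K a f → fMul K (shift a f) ≗ shift a (fMul K f)
fMul-shift K a f k = trans
  (∑-cong (allSubsets (n K)) (λ σ → cong (𝟙[ face K σ ] *_) (shift-comm ∣ σ ∣ a f k)))
  (sym (shift-linear a (allSubsets (n K)) (λ σ → 𝟙[ face K σ ]) (λ σ → shift ∣ σ ∣ f) k))

fMul-⋆ : ∀ K L f → fMul (K ⋆ L) f ≗ fMul K (fMul L f)
fMul-⋆ K L f k = begin
  ∑[ ρ ∈ allSubsets (n K + n L) ]
    (𝟙[ face K (take (n K) ρ) ∧ face L (drop (n K) ρ) ] * shift ∣ ρ ∣ f k)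
    ≡⟨ ∑-cong (allSubsets (n K + n L)) (λ ρ →
         cong (λ s → 𝟙[ face K (take (n K) ρ) ∧ face L (drop (n K) ρ) ] * shift s f k)
              (∣ρ∣≡∣take∣+∣drop∣ (n K) ρ)) ⟩
  ∑[ ρ ∈ allSubsets (n K + n L) ] F (take (n K) ρ) (drop (n K) ρ)
    ≡⟨ ∑-allSubsets-+ (n K) (n L) F ⟩
  ∑[ σ ∈ allSubsets (n K) ] ∑ (allSubsets (n L)) (F σ)
    ≡⟨ ∑-cong (allSubsets (n K)) factor ⟩
  fMul K (fMul L f) k ∎
  where
  F : Subset (n K) → Subset (n L) → ℕ
  F σ τ = 𝟙[ face K σ ∧ face L τ ] * shift (∣ σ ∣ + ∣ τ ∣) f k

  factor : ∀ σ → ∑ (allSubsets (n L)) (F σ) ≡ 𝟙[ face K σ ] * shift ∣ σ ∣ (fMul L f) k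
  factor σ = begin
    ∑ T (F σ)
      ≡⟨ ∑-cong T (λ τ → trans (𝟙[∧] (face K σ) (face L τ) _)
           (cong (λ t → 𝟙[ face K σ ] * (𝟙[ face L τ ] * t)) (sym (shift-shift ∣ σ ∣ ∣ τ ∣ f k)))) ⟩
    ∑[ τ ∈ T ] (𝟙[ face K σ ] * (𝟙[ face L τ ] * shift ∣ σ ∣ (shift ∣ τ ∣ f) k))
      ≡⟨ *-distribˡ-∑ 𝟙[ face K σ ] T _ ⟨
    𝟙[ face K σ ] * ∑[ τ ∈ T ] (𝟙[ face L τ ] * shift ∣ σ ∣ (shift ∣ τ ∣ f) k)
      ≡⟨ cong (𝟙[ face K σ ] *_)
              (shift-linear ∣ σ ∣ T (λ τ → 𝟙[ face L τ ]) (λ τ → shift ∣ τ ∣ f) k) ⟨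
    𝟙[ face K σ ] * shift ∣ σ ∣ (fMul L f) k ∎
    where T = allSubsets (n L)

fMul-emptyFaceComplex : ∀ f → fMul emptyFaceComplex f ≗ f
fMul-emptyFaceComplex f k = trans (+-identityʳ _) (*-identityˡ _)

fMul-∂σ0 : ∀ f → fMul (∂σ 0) f ≗ f
fMul-∂σ0 f k = trans (+-identityʳ _) (*-identityˡ _)

-- The faces of ∂σ^(m+1) through its first vertex are that vertex joined to a face of ∂σ^m;
-- those avoiding it are all subsets of the other m + 1 vertices: the faces of ∂σ^m and the
-- full set.
fMul-∂σ-suc : ∀ m f → fMul (∂σ (suc m)) f ≗ fMul (∂σ m) f ⊕ shift 1 (fMul (∂σ m) f) ⊕ shift (suc m) f
fMul-∂σ-suc m f k = begin
  fMul (∂σ (suc m)) f k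
    ≡⟨ ∑-allSubsets-suc (suc m) _ ⟩
  ∑[ τ ∈ S ] (𝟙[ not (isFull τ) ] * shift (suc ∣ τ ∣) f k) + ∑[ τ ∈ S ] (1 * shift ∣ τ ∣ f k)
    ≡⟨ cong₂ _+_ (throughVertex k) avoidingVertex ⟩
  shift 1 P k + (P k + shift (suc m) f k)
    ≡⟨ x∙yz≈yx∙z (shift 1 P k) (P k) _ ⟩
  P k + shift 1 P k + shift (suc m) f k ∎
  where
  S = allSubsets (suc m)
  P = fMul (∂σ m) f

  throughVertex : ∀ k → ∑[ τ ∈ S ] (𝟙[ not (isFull τ) ] * shift (suc ∣ τ ∣) f k) ≡ shift 1 P k
  throughVertex zero    = ∑-*-zeroʳ S (λ τ → 𝟙[ not (isFull τ) ])
  throughVertex (suc k) = refl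

  avoidingVertex : ∑[ τ ∈ S ] (1 * shift ∣ τ ∣ f k) ≡ P k + shift (suc m) f k
  avoidingVertex = begin
    ∑[ τ ∈ S ] (1 * shift ∣ τ ∣ f k)
      ≡⟨ ∑-cong S (λ τ → trans (*-identityˡ _) (sym (𝟙[not-b]+𝟙[b] (isFull τ) _))) ⟩
    ∑[ τ ∈ S ] (𝟙[ not (isFull τ) ] * (shift ∣ τ ∣ f k) + 𝟙[ isFull τ ] * (shift ∣ τ ∣ f k))
      ≡⟨ ∑-⊕ S _ _ ⟩
    P k + ∑[ τ ∈ S ] (𝟙[ isFull τ ] * shift ∣ τ ∣ f k)
      ≡⟨ cong (_+_ (P k)) (∑-allSubsets-isFull (suc m) (λ a → shift a f k)) ⟩
    P k + shift (suc m) f k ∎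

fMul^ : SC → ℕ → (ℕ → ℕ) → ℕ → ℕ
fMul^ K zero    f = f
fMul^ K (suc q) f = fMul K (fMul^ K q f)

fMul^-cong : ∀ K q {f g} → f ≗ g → fMul^ K q f ≗ fMul^ K q g
fMul^-cong K zero    f≗g = f≗g
fMul^-cong K (suc q) f≗g = fMul-cong K (fMul^-cong K q f≗g)

fMul^-⊕ : ∀ K q f g → fMul^ K q (f ⊕ g) ≗ fMul^ K q f ⊕ fMul^ K q g
fMul^-⊕ K zero    f g k = refl
fMul^-⊕ K (suc q) f g k =
  trans (fMul-cong K (fMul^-⊕ K q f g) k) (fMul-⊕ K (fMul^ K q f) (fMul^ K q g) k)

fMul^-shift : ∀ K q a f → fMul^ K q (shift a f) ≗ shift a (fMul^ K q f)
fMul^-shift K zero    a f k = refl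
fMul^-shift K (suc q) a f k =
  trans (fMul-cong K (fMul^-shift K q a f) k) (fMul-shift K a (fMul^ K q f) k)

fMul^-fMul : ∀ K q f → fMul^ K q (fMul K f) ≗ fMul^ K (suc q) f
fMul^-fMul K zero    f k = refl
fMul^-fMul K (suc q) f = fMul-cong K (fMul^-fMul K q f)

fMul-joinPow : ∀ q K L f → fMul (joinPow q K L) f ≗ fMul^ K q (fMul L f)
fMul-joinPow zero    K L f k = refl
fMul-joinPow (suc q) K L f k =
  trans (fMul-⋆ K (joinPow q K L) f k) (fMul-cong K (fMul-joinPow q K L f) k)

[q*n+r]/n≡q : ∀ q {n r} .{{_ : NonZero n}} → r < n → (q * n + r) / n ≡ q
[q*n+r]/n≡q q {n} {r} r<n = begin
  (q * n + r) / n   ≡⟨ +-distrib-/-∣ˡ r (n∣m*n q) ⟩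
  q * n / n + r / n ≡⟨ cong₂ _+_ (m*n/n≡m q n) (m<n⇒m/n≡0 r<n) ⟩
  q + 0             ≡⟨ +-identityʳ q ⟩
  q                 ∎

[q*n+r]%n≡r : ∀ q {n r} .{{_ : NonZero n}} → r < n → (q * n + r) % n ≡ r
[q*n+r]%n≡r q {n} {r} r<n = begin
  (q * n + r) % n ≡⟨ cong (_% n) (+-comm (q * n) r) ⟩
  (r + q * n) % n ≡⟨ [m+kn]%n≡m%n r q n ⟩
  r % n           ≡⟨ m<n⇒m%n≡m r<n ⟩
  r               ∎

module _ {i′ : ℕ} (h : 0 < suc i′) where

  Sph-suc : ∀ q r → r < suc i′ →
    Sph (suc i′) h (suc (q * suc i′ + r)) ≡ joinPow q (∂σ (suc i′)) (∂σ (suc r))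
  Sph-suc q r r<i = cong₂ (λ a b → joinPow a (∂σ (suc i′)) (∂σ (suc b)))
                          ([q*n+r]/n≡q q r<i) ([q*n+r]%n≡r q r<i)

  fMul-Sph-suc : ∀ q r → r < suc i′ → ∀ f →
    fMul (Sph (suc i′) h (suc (q * suc i′ + r))) f ≗ fMul^ (∂σ (suc i′)) q (fMul (∂σ (suc r)) f)
  fMul-Sph-suc q r r<i f rewrite Sph-suc q r r<i = fMul-joinPow q (∂σ (suc i′)) (∂σ (suc r)) f

  fMul-Sph-q*i : ∀ q f → fMul (Sph (suc i′) h (q * suc i′)) f ≗ fMul^ (∂σ (suc i′)) q f
  fMul-Sph-q*i zero    f = fMul-emptyFaceComplex f
  fMul-Sph-q*i (suc q) f k = begin
    fMul (Sph (suc i′) h (suc (i′ + q * suc i′))) f k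
      ≡⟨ cong (λ e → fMul (Sph (suc i′) h (suc e)) f k) (+-comm i′ (q * suc i′)) ⟩
    fMul (Sph (suc i′) h (suc (q * suc i′ + i′))) f k
      ≡⟨ fMul-Sph-suc q i′ ℕ.≤-refl f k ⟩
    fMul^ (∂σ (suc i′)) q (fMul (∂σ (suc i′)) f) k
      ≡⟨ fMul^-fMul (∂σ (suc i′)) q f k ⟩
    fMul^ (∂σ (suc i′)) (suc q) f k ∎

  fMul-Sph : ∀ q r → r < suc i′ → ∀ f →
    fMul (Sph (suc i′) h (q * suc i′ + r)) f ≗ fMul^ (∂σ (suc i′)) q (fMul (∂σ r) f)
  fMul-Sph q zero    _   f k = begin
    fMul (Sph (suc i′) h (q * suc i′ + 0)) f k
      ≡⟨ cong (λ e → fMul (Sph (suc i′) h e) f k) (+-identityʳ (q * suc i′)) ⟩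
    fMul (Sph (suc i′) h (q * suc i′)) f k
      ≡⟨ fMul-Sph-q*i q f k ⟩
    fMul^ (∂σ (suc i′)) q f k
      ≡⟨ fMul^-cong (∂σ (suc i′)) q (sym ∘ fMul-∂σ0 f) k ⟩
    fMul^ (∂σ (suc i′)) q (fMul (∂σ 0) f) k ∎
  fMul-Sph q (suc r) r<i f k = begin
    fMul (Sph (suc i′) h (q * suc i′ + suc r)) f k
      ≡⟨ cong (λ e → fMul (Sph (suc i′) h e) f k) (+-suc (q * suc i′) r) ⟩
    fMul (Sph (suc i′) h (suc (q * suc i′ + r))) f k
      ≡⟨ fMul-Sph-suc q r (ℕ.<⇒≤ r<i) f k ⟩
    fMul^ (∂σ (suc i′)) q (fMul (∂σ (suc r)) f) k ∎

  fMul-Sph-recurrence : ∀ {d} q r → d ≡ q * suc i′ + r → r < suc i′ → ∀ f →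
    fMul (Sph (suc i′) h (suc d)) f ≗
      fMul (Sph (suc i′) h d) f ⊕ shift 1 (fMul (Sph (suc i′) h d) f)
      ⊕ shift (suc r) (fMul (Sph (suc i′) h (d ∸ r)) f)
  fMul-Sph-recurrence q r refl r<i f k = begin
    fMul (Sph (suc i′) h (suc (q * suc i′ + r))) f k
      ≡⟨ fMul-Sph-suc q r r<i f k ⟩
    Δ^q (fMul (∂σ (suc r)) f) k
      ≡⟨ fMul^-cong Δ q (fMul-∂σ-suc r f) k ⟩
    Δ^q (P ⊕ shift 1 P ⊕ shift (suc r) f) k
      ≡⟨ fMul^-⊕ Δ q (P ⊕ shift 1 P) (shift (suc r) f) k ⟩
    Δ^q (P ⊕ shift 1 P) k + Δ^q (shift (suc r) f) k
      ≡⟨ cong₂ _+_ (fMul^-⊕ Δ q P (shift 1 P) k) (fMul^-shift Δ q (suc r) f k) ⟩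
    Δ^q P k + Δ^q (shift 1 P) k + shift (suc r) (Δ^q f) k
      ≡⟨ cong (λ t → Δ^q P k + t + shift (suc r) (Δ^q f) k) (fMul^-shift Δ q 1 P k) ⟩
    Δ^q P k + shift 1 (Δ^q P) k + shift (suc r) (Δ^q f) k
      ≡⟨ cong₂ _+_ (cong₂ _+_ (fMul-Sph q r r<i f k) (shift-cong 1 (fMul-Sph q r r<i f) k))
                   (shift-cong (suc r) truncated k) ⟨
    fMul (Sph (suc i′) h (q * suc i′ + r)) f k
      + shift 1 (fMul (Sph (suc i′) h (q * suc i′ + r)) f) k
      + shift (suc r) (fMul (Sph (suc i′) h (q * suc i′ + r ∸ r)) f) k ∎
    where
    Δ = ∂σ (suc i′)
    Δ^q = fMul^ Δ q
    P = fMul (∂σ r) f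

    truncated : fMul (Sph (suc i′) h (q * suc i′ + r ∸ r)) f ≗ Δ^q f
    truncated k = trans (cong (λ e → fMul (Sph (suc i′) h e) f k) (m+n∸n≡m (q * suc i′) r))
                        (fMul-Sph-q*i q f k)

extendℤ : (ℕ → ℕ) → ℤ → ℕ
extendℤ f (+ k)      = f k
extendℤ f ℤ.-[1+ _ ] = 0

extendℤ-cong : ∀ {f g} → f ≗ g → ∀ z → extendℤ f z ≡ extendℤ g z
extendℤ-cong f≗g (+ k)      = f≗g k
extendℤ-cong f≗g ℤ.-[1+ _ ] = refl

extendℤ-⊕ : ∀ f g z → extendℤ (f ⊕ g) z ≡ extendℤ f z + extendℤ g z
extendℤ-⊕ f g (+ k)      = refl
extendℤ-⊕ f g ℤ.-[1+ _ ] = refl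

extendℤ-linear : (xs : List A) (c : A → ℕ) (h : A → ℕ → ℕ) → ∀ z →
  extendℤ (λ k → ∑[ x ∈ xs ] (c x * h x k)) z ≡ ∑[ x ∈ xs ] (c x * extendℤ (h x) z)
extendℤ-linear xs c h (+ k)      = refl
extendℤ-linear xs c h ℤ.-[1+ _ ] = sym (∑-*-zeroʳ xs c)

extendℤ-⊖ : ∀ f k r → extendℤ f (k ℤ.⊖ r) ≡ shift r f k
extendℤ-⊖ f k       zero    = refl
extendℤ-⊖ f zero    (suc r) = refl
extendℤ-⊖ f (suc k) (suc r) = trans (cong (extendℤ f) (ℤ.[1+m]⊖[1+n]≡m⊖n k r)) (extendℤ-⊖ f k r)

extendℤ-shift : ∀ a f z → extendℤ (shift a f) z ≡ extendℤ f (z - + a)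
extendℤ-shift zero    f (+ k)      = cong f (sym (+-identityʳ k))
extendℤ-shift (suc a) f (+ k)      = sym (extendℤ-⊖ f k (suc a))
extendℤ-shift zero    f ℤ.-[1+ _ ] = refl
extendℤ-shift (suc a) f ℤ.-[1+ _ ] = refl

𝟙[≟]≡shift-δ₀ : ∀ a k → 𝟙[ does (a ℕ.≟ k) ] ≡ shift a δ₀ k
𝟙[≟]≡shift-δ₀ zero    zero    = refl
𝟙[≟]≡shift-δ₀ zero    (suc k) = refl
𝟙[≟]≡shift-δ₀ (suc a) zero    = refl
𝟙[≟]≡shift-δ₀ (suc a) (suc k) = 𝟙[≟]≡shift-δ₀ a k

𝟙[face-of-size] : ∀ b a z →
  𝟙[ does (T? b ×-dec (+ a ℤ.≟ z)) ] ≡ 𝟙[ b ] * extendℤ (shift a δ₀) z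
𝟙[face-of-size] false a z          = refl
𝟙[face-of-size] true  a (+ k)      = trans (𝟙[≟]≡shift-δ₀ a k) (sym (+-identityʳ _))
𝟙[face-of-size] true  a ℤ.-[1+ _ ] = refl

fnum≡faceCount : ∀ j K → fnum j K ≡ extendℤ (faceCount K) (j ℤ.+ 1ℤ)
fnum≡faceCount j K = begin
  fnum j K
    ≡⟨ length-filter≡∑ _ S ⟩
  ∑[ σ ∈ S ] 𝟙[ does (T? (face K σ) ×-dec (+ ∣ σ ∣ ℤ.≟ z)) ]
    ≡⟨ ∑-cong S (λ σ → 𝟙[face-of-size] (face K σ) ∣ σ ∣ z) ⟩
  ∑[ σ ∈ S ] (𝟙[ face K σ ] * extendℤ (shift ∣ σ ∣ δ₀) z)
    ≡⟨ extendℤ-linear S (λ σ → 𝟙[ face K σ ]) (λ σ → shift ∣ σ ∣ δ₀) z ⟨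
  extendℤ (faceCount K) z ∎
  where
  S = allSubsets (n K)
  z = j ℤ.+ 1ℤ

fnum-∸≡shift-faceCount : ∀ j a K → fnum (j - + a) K ≡ extendℤ (shift a (faceCount K)) (j ℤ.+ 1ℤ)
fnum-∸≡shift-faceCount j a K = begin
  fnum (j - + a) K                                  ≡⟨ fnum≡faceCount (j - + a) K ⟩
  extendℤ (faceCount K) (j - + a ℤ.+ 1ℤ)            ≡⟨ cong (extendℤ (faceCount K)) (xy∙z≈xz∙y j (ℤ.- + a) 1ℤ) ⟩
  extendℤ (faceCount K) (j ℤ.+ 1ℤ - + a)            ≡⟨ extendℤ-shift a (faceCount K) (j ℤ.+ 1ℤ) ⟨
  extendℤ (shift a (faceCount K)) (j ℤ.+ 1ℤ)        ∎

lemma2p4 : (d i : ℕ) (h : 0 < i) → i ≤ suc d → (j : ℤ) → (q r : ℕ) →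
    suc d ≡ q * i + r → 1 ≤ r → r ≤ i →
    fnum j (Sph i h (suc d)) ≡
    fnum j (Sph i h d) + fnum (j - 1ℤ) (Sph i h d) + fnum (j - + r) (Sph i h (suc d ∸ r))
lemma2p4 d zero     () _ j q r       _  _ _
lemma2p4 d (suc i′) h  _ j q zero    _  () _
lemma2p4 d (suc i′) h  _ j q (suc r) eq _ r<i = begin
  fnum j X
    ≡⟨ fnum≡faceCount j X ⟩
  extendℤ (faceCount X) z
    ≡⟨ extendℤ-cong (fMul-Sph-recurrence h q r d≡q*i+r r<i δ₀) z ⟩
  extendℤ (faceCount Y ⊕ shift 1 (faceCount Y) ⊕ shift (suc r) (faceCount W)) z
    ≡⟨ extendℤ-⊕ (faceCount Y ⊕ shift 1 (faceCount Y)) _ z ⟩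
  extendℤ (faceCount Y ⊕ shift 1 (faceCount Y)) z + extendℤ (shift (suc r) (faceCount W)) z
    ≡⟨ cong (_+ extendℤ (shift (suc r) (faceCount W)) z) (extendℤ-⊕ (faceCount Y) _ z) ⟩
  extendℤ (faceCount Y) z + extendℤ (shift 1 (faceCount Y)) z
    + extendℤ (shift (suc r) (faceCount W)) z
    ≡⟨ cong₂ _+_ (cong₂ _+_ (fnum≡faceCount j Y) (fnum-∸≡shift-faceCount j 1 Y))
                 (fnum-∸≡shift-faceCount j (suc r) W) ⟨
  fnum j Y + fnum (j - 1ℤ) Y + fnum (j - + suc r) W ∎
  where
  X = Sph (suc i′) h (suc d)
  Y = Sph (suc i′) h d
  W = Sph (suc i′) h (d ∸ r)
  z = j ℤ.+ 1ℤ
  d≡q*i+r : d ≡ q * suc i′ + r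
  d≡q*i+r = suc-injective (trans eq (+-suc (q * suc i′) r))
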